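{- Let $H$ be a subgroup of index $2$ of a finite group $G$. Then for every odd integer $k$, $\mathrm{roots}_k^H=\mathrm{roots}_k^G|_H$.
   Context: For a finite group $G$ and integer $k$, $\mathrm{roots}_k^G(g)=|\{h\in G:h^k=g\}|$; $\mathrm{roots}_k^G|_H$ denotes its restriction to $H$. -}

module Defs where

open import Level using (Level; _⊔_; suc)
open import Algebra.Bundles using (Group)
open import Data.Nat using (ℕ; zero) renaming (suc to sucℕ)
open import Data.Integer using (ℤ; +_; -[1+_])
open import Data.Fin using (Fin)
open import Data.List using (length; filter; allFin)
open import Data.Product using (_×_; Σ)
open import Function.Definitions using (Injective; Surjective)
open import Relation.Binary.PropositionalEquality using (_≡_)
open import Relation.Nullary using (¬_; Dec)
open import Relation.Unary using (Pred)
import Relation.Binary.Definitions as BD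
open import Relation.Nullary.Decidable using (_×-dec_)
import Data.Nat
import Relation.Unary

record FiniteGroup (c ℓ : Level) : Set (suc (c ⊔ ℓ)) where
  field
    group : Group c ℓ
  open Group group public
  field
    order    : ℕ
    enum     : Fin order → Carrier
    enum-inj : ∀ i j → enum i ≈ enum j → i ≡ j
    enum-sur : ∀ x → Σ (Fin order) (λ i → enum i ≈ x)
    _≟_      : BD.Decidable _≈_

module _ {c ℓ : Level} (G : FiniteGroup c ℓ) where
  open FiniteGroup G

  powℕ : Carrier → ℕ → Carrier
  powℕ x zero     = ε
  powℕ x (sucℕ m) = x ∙ powℕ x m

  pow : Carrier → ℤ → Carrier
  pow x (+ m)      = powℕ x m
  pow x -[1+ m ]   = (powℕ x (sucℕ m)) ⁻¹

  countG : {p : Level} {P : Pred Carrier p} → Relation.Unary.Decidable P → ℕ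
  countG P? = length (filter (λ i → P? (enum i)) (allFin order))

  record Subgroup (p : Level) : Set (c ⊔ ℓ ⊔ Level.suc p) where
    field
      mem     : Pred Carrier p
      mem?    : Relation.Unary.Decidable mem
      resp    : ∀ {x y} → x ≈ y → mem x → mem y
      ε-mem   : mem ε
      ∙-mem   : ∀ {x y} → mem x → mem y → mem (x ∙ y)
      ⁻¹-mem  : ∀ {x} → mem x → mem (x ⁻¹)

  subOrder : {p : Level} → Subgroup p → ℕ
  subOrder H = countG (Subgroup.mem? H)

  -- [G : H] = 2, i.e. |G| = 2·|H| (G finite, Lagrange)
  Index2 : {p : Level} → Subgroup p → Set
  Index2 H = order ≡ 2 Data.Nat.* subOrder H

  rootsG : ℤ → Carrier → ℕ
  rootsG k g = countG (λ h → pow h k ≟ g)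

  -- roots_k^H(g) = |{h ∈ H : h^k = g}|  (power computed in H = computed in G)
  rootsH : {p : Level} → Subgroup p → ℤ → Carrier → ℕ
  rootsH H k g = countG (λ h → Subgroup.mem? H h ×-dec (pow h k ≟ g))

-- For x ∉ H, left multiplication by x maps H into G ∖ H; as both sets have |G| / 2 elements it maps
-- H onto G ∖ H, so a product of two elements outside H lies in H. Hence h ∉ H forces h^k ∉ H for
-- odd k, so every k-th root in G of an element of H already lies in H.
module Submission where

open import Defs
open import Level using (Level)
open import Data.Integer using (ℤ; +_; -[1+_])
open import Data.Integer.Divisibility using (_∣_)
import Data.Nat.Divisibility as ℕ
open import Data.Nat using (ℕ; zero; suc; _+_; _*_; _≤_; z≤n)
open import Data.Nat.Properties
  using (+-0-commutativeMonoid; +-mono-≤; +-monoʳ-≤; +-cancelʳ-≤; +-cancelˡ-≡; +-identityʳ; ≤-antisym; ≤-refl)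
open import Algebra.Properties.CommutativeMonoid.Sum +-0-commutativeMonoid
  using (sum; sum-permute; sum-cong-≗; ∑-distrib-+)
open import Data.Fin using (Fin)
open import Data.Fin.Permutation using (Permutation; permutation; _⟨$⟩ʳ_)
open import Data.List using (length; filter; tabulate; allFin)
open import Data.List.Properties using (filter-≐)
open import Data.Product using (_,_; proj₁; proj₂; _×_)
open import Relation.Nullary using (¬_; Dec; yes; no; ¬?; contradiction)
open import Relation.Nullary.Decidable using (_×-dec_)
open import Relation.Unary using (Pred; Decidable; _⊆_)
open import Relation.Unary.Properties using (∁?)
open import Relation.Binary.Definitions using (_Respects_)
open import Relation.Binary.PropositionalEquality using (_≡_; refl; cong; cong₂; sym; trans; subst; module ≡-Reasoning)
import Algebra.Properties.Group as GroupProperties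
import Relation.Binary.Reasoning.Setoid as SetoidReasoning

indicator : ∀ {a} {A : Set a} → Dec A → ℕ
indicator (yes _) = 1
indicator (no _)  = 0

indicator-mono : ∀ {a b} {A : Set a} {B : Set b} → (A → B) → (a? : Dec A) (b? : Dec B) →
                 indicator a? ≤ indicator b?
indicator-mono f (yes a) (yes _) = ≤-refl
indicator-mono f (yes a) (no ¬b) = contradiction (f a) ¬b
indicator-mono f (no _)  _       = z≤n

indicator-+-¬ : ∀ {a} {A : Set a} (a? : Dec A) → indicator a? + indicator (¬? a?) ≡ 1
indicator-+-¬ (yes _) = refl
indicator-+-¬ (no _)  = refl

indicator≡1⇔ : ∀ {a} {A : Set a} (a? : Dec A) → (A → indicator a? ≡ 1) × (indicator a? ≡ 1 → A)
indicator≡1⇔ (yes a) = (λ _ → refl) , (λ _ → a)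
indicator≡1⇔ (no ¬a) = (λ a → contradiction a ¬a) , λ ()

sum-const-1 : ∀ n → sum {n} (λ _ → 1) ≡ n
sum-const-1 zero    = refl
sum-const-1 (suc n) = cong suc (sum-const-1 n)

sum-mono-≤ : ∀ {n} {f g : Fin n → ℕ} → (∀ i → f i ≤ g i) → sum f ≤ sum g
sum-mono-≤ {zero}  f≤g = z≤n
sum-mono-≤ {suc n} f≤g = +-mono-≤ (f≤g Fin.zero) (sum-mono-≤ (λ i → f≤g (Fin.suc i)))

+-mono-≤-≡⇒≡ : ∀ {a b c d} → a ≤ b → c ≤ d → a + c ≡ b + d → a ≡ b × c ≡ d
+-mono-≤-≡⇒≡ {a} {b} {c} {d} a≤b c≤d eq = a≡b , +-cancelˡ-≡ a c d (trans eq (cong (_+ d) (sym a≡b)))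
  where
  b≤a : b ≤ a
  b≤a = +-cancelʳ-≤ c b a (subst (b + c ≤_) (sym eq) (+-monoʳ-≤ b c≤d))
  a≡b : a ≡ b
  a≡b = ≤-antisym a≤b b≤a

sum-mono-≤-≡⇒≗ : ∀ {n} {f g : Fin n → ℕ} → (∀ i → f i ≤ g i) → sum f ≡ sum g → ∀ i → f i ≡ g i
sum-mono-≤-≡⇒≗ {suc n} f≤g eq Fin.zero    =
  proj₁ (+-mono-≤-≡⇒≡ (f≤g Fin.zero) (sum-mono-≤ (λ i → f≤g (Fin.suc i))) eq)
sum-mono-≤-≡⇒≗ {suc n} f≤g eq (Fin.suc i) =
  sum-mono-≤-≡⇒≗ (λ j → f≤g (Fin.suc j))
    (proj₂ (+-mono-≤-≡⇒≡ (f≤g Fin.zero) (sum-mono-≤ (λ j → f≤g (Fin.suc j))) eq)) i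

count : ∀ {n p} {P : Pred (Fin n) p} → Decidable P → ℕ
count {n} P? = length (filter P? (allFin n))

count≡sum : ∀ {n p} {P : Pred (Fin n) p} (P? : Decidable P) → count P? ≡ sum (λ i → indicator (P? i))
count≡sum {n} P? = go (λ i → i)
  where
  go : ∀ {m} (f : Fin m → Fin n) → length (filter P? (tabulate f)) ≡ sum (λ i → indicator (P? (f i)))
  go {zero}  f = refl
  go {suc m} f with P? (f Fin.zero)
  ... | yes _ = cong suc (go (λ i → f (Fin.suc i)))
  ... | no _  = go (λ i → f (Fin.suc i))

module _ {n p} {P : Pred (Fin n) p} (P? : Decidable P) where

  count-permute : (π : Permutation n n) → count (λ i → P? (π ⟨$⟩ʳ i)) ≡ count P?
  count-permute π = begin
    count (λ i → P? (π ⟨$⟩ʳ i))                ≡⟨ count≡sum (λ i → P? (π ⟨$⟩ʳ i)) ⟩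
    sum (λ i → indicator (P? (π ⟨$⟩ʳ i)))      ≡⟨ sum-permute (λ i → indicator (P? i)) π ⟨
    sum (λ i → indicator (P? i))                ≡⟨ count≡sum P? ⟨
    count P?                                    ∎
    where open ≡-Reasoning

  count-+-count-∁ : count P? + count (∁? P?) ≡ n
  count-+-count-∁ = begin
    count P? + count (∁? P?)                                         ≡⟨ cong₂ _+_ (count≡sum P?) (count≡sum (∁? P?)) ⟩
    sum (λ i → indicator (P? i)) + sum (λ i → indicator (¬? (P? i))) ≡⟨ ∑-distrib-+ (λ i → indicator (P? i)) (λ i → indicator (¬? (P? i))) ⟨
    sum (λ i → indicator (P? i) + indicator (¬? (P? i)))             ≡⟨ sum-cong-≗ (λ i → indicator-+-¬ (P? i)) ⟩
    sum {n} (λ _ → 1)                                                ≡⟨ sum-const-1 n ⟩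
    n                                                                ∎
    where open ≡-Reasoning

module _ {n p q} {P : Pred (Fin n) p} {Q : Pred (Fin n) q} (P? : Decidable P) (Q? : Decidable Q) where

  count-⊆-≡⇒⊇ : P ⊆ Q → count P? ≡ count Q? → Q ⊆ P
  count-⊆-≡⇒⊇ P⊆Q eq {i} Qi =
    proj₂ (indicator≡1⇔ (P? i)) (trans (same i) (proj₁ (indicator≡1⇔ (Q? i)) Qi))
    where
    same : ∀ i → indicator (P? i) ≡ indicator (Q? i)
    same = sum-mono-≤-≡⇒≗ (λ i → indicator-mono P⊆Q (P? i) (Q? i))
             (trans (sym (count≡sum P?)) (trans eq (count≡sum Q?)))

module _ {c ℓ} (G : FiniteGroup c ℓ) where
  open FiniteGroup G hiding (refl; trans) renaming (sym to ≈-sym)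

  index : Carrier → Fin order
  index x = proj₁ (enum-sur x)

  enum-index : ∀ x → enum (index x) ≈ x
  enum-index x = proj₂ (enum-sur x)

  translate : Carrier → Fin order → Fin order
  translate x i = index (x ∙ enum i)

  translate-cancel : ∀ {x y} → x ∙ y ≈ ε → ∀ i → translate x (translate y i) ≡ i
  translate-cancel {x} {y} xy≈ε i = enum-inj _ _ (begin
    enum (translate x (translate y i)) ≈⟨ enum-index _ ⟩
    x ∙ enum (translate y i)           ≈⟨ ∙-congˡ (enum-index _) ⟩
    x ∙ (y ∙ enum i)                   ≈⟨ assoc x y (enum i) ⟨
    (x ∙ y) ∙ enum i                   ≈⟨ ∙-congʳ xy≈ε ⟩
    ε ∙ enum i                         ≈⟨ identityˡ (enum i) ⟩
    enum i                             ∎)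
    where open SetoidReasoning setoid

  translation : Carrier → Permutation order order
  translation x = permutation (translate x) (translate (x ⁻¹))
    (translate-cancel (inverseʳ x)) (translate-cancel (inverseˡ x))

  countG-translate : ∀ {p} {P : Pred Carrier p} (P? : Decidable P) → P Respects _≈_ →
                     ∀ x → countG G (λ y → P? (x ∙ y)) ≡ countG G P?
  countG-translate P? resp x =
    trans (cong length (filter-≐ _ _ (resp (≈-sym (enum-index _)) , resp (enum-index _)) (allFin order)))
          (count-permute (λ i → P? (enum i)) (translation x))

  module _ {p} (H : Subgroup G p) where
    open Subgroup H
    open GroupProperties group using (⁻¹-involutive)

    ∉-∙-∈ : ∀ {x y} → ¬ mem x → mem y → ¬ mem (x ∙ y)
    ∉-∙-∈ {x} {y} x∉H y∈H xy∈H = x∉H (resp xy∙y⁻¹≈x (∙-mem xy∈H (⁻¹-mem y∈H)))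
      where
      xy∙y⁻¹≈x : (x ∙ y) ∙ y ⁻¹ ≈ x
      xy∙y⁻¹≈x = begin
        (x ∙ y) ∙ y ⁻¹ ≈⟨ assoc x y (y ⁻¹) ⟩
        x ∙ (y ∙ y ⁻¹) ≈⟨ ∙-congˡ (inverseʳ y) ⟩
        x ∙ ε          ≈⟨ identityʳ x ⟩
        x              ∎
        where open SetoidReasoning setoid

    ∉⇒⁻¹-∉ : ∀ {x} → ¬ mem x → ¬ mem (x ⁻¹)
    ∉⇒⁻¹-∉ {x} x∉H x⁻¹∈H = x∉H (resp (⁻¹-involutive x) (⁻¹-mem x⁻¹∈H))

    module _ (index2 : Index2 G H) where

      countG-∉≡subOrder : countG G (∁? mem?) ≡ subOrder G H
      countG-∉≡subOrder = +-cancelˡ-≡ (subOrder G H) _ _ (begin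
        subOrder G H + countG G (∁? mem?) ≡⟨ count-+-count-∁ (λ i → mem? (enum i)) ⟩
        order                             ≡⟨ index2 ⟩
        2 * subOrder G H                  ≡⟨ cong (λ n → subOrder G H + n) (+-identityʳ (subOrder G H)) ⟩
        subOrder G H + subOrder G H       ∎)
        where open ≡-Reasoning

      ∉-∙-∉ : ∀ {x y} → ¬ mem x → ¬ mem y → mem (x ∙ y)
      ∉-∙-∉ {x} {y} x∉H y∉H = resp (∙-congˡ (enum-index y)) (count-⊆-≡⇒⊇
        (λ i → mem? (x ∙ enum i)) (λ i → ¬? (mem? (enum i)))
        (λ x·i∈H i∈H → ∉-∙-∈ x∉H i∈H x·i∈H)
        (trans (countG-translate mem? resp x) (sym countG-∉≡subOrder))
        (λ i∈H → y∉H (resp (enum-index y) i∈H)))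

      powℕ-odd-∉ : ∀ {h} → ¬ mem h → ∀ m → ¬ 2 ℕ.∣ m → ¬ mem (powℕ G h m)
      powℕ-odd-∉ h∉H zero          odd = contradiction (2 ℕ.∣0) odd
      powℕ-odd-∉ h∉H (suc zero)    odd = ∉-∙-∈ h∉H ε-mem
      powℕ-odd-∉ h∉H (suc (suc m)) odd =
        ∉-∙-∈ h∉H (∉-∙-∉ h∉H (powℕ-odd-∉ h∉H m (λ 2∣m → odd (ℕ.∣m∣n⇒∣m+n ℕ.∣-refl 2∣m))))

      pow-odd-∉ : ∀ {h} → ¬ mem h → ∀ k → ¬ (+ 2) ∣ k → ¬ mem (pow G h k)
      pow-odd-∉ h∉H (+ m)      odd = powℕ-odd-∉ h∉H m odd
      pow-odd-∉ h∉H -[1+ m ]   odd = ∉⇒⁻¹-∉ (powℕ-odd-∉ h∉H (suc m) odd)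

      odd-root-∈ : ∀ {k g h} → ¬ (+ 2) ∣ k → mem g → pow G h k ≈ g → mem h
      odd-root-∈ {k} {g} {h} odd g∈H hᵏ≈g with mem? h
      ... | yes h∈H = h∈H
      ... | no h∉H  = contradiction (resp (≈-sym hᵏ≈g) g∈H) (pow-odd-∉ h∉H k odd)

lemma6p13 : {c ℓ p : Level} (G : FiniteGroup c ℓ) (H : Subgroup G p) → Index2 G H →
    (k : ℤ) → ¬ ((+ 2) ∣ k) →
    ∀ g → Subgroup.mem H g → rootsH G H k g ≡ rootsG G k g
lemma6p13 G H index2 k odd g g∈H =
  cong length (filter-≐ (λ i → mem? (enum i) ×-dec (pow G (enum i) k ≟ g)) (λ i → pow G (enum i) k ≟ g)
    (proj₂ , λ hᵏ≈g → odd-root-∈ G H index2 {k} odd g∈H hᵏ≈g , hᵏ≈g) (allFin order))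
  where
  open FiniteGroup G using (enum; order; _≟_)
  open Subgroup H using (mem?)
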